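{- Let $G$ be a group of order $v$, written additively (not necessarily abelian), and let $A=\{A_1,\dots,A_m\}$ be a non-disjoint $(v,m,k_1,\dots,k_m)$-GPSEDF in $G$. Then: (i) For each $1\le j\le m$, $\{A_1,\dots,A_{j-1},\overline{A_j},A_{j+1},\dots,A_m\}$ is a non-disjoint $(v,m,k_1,\dots,k_{j-1},v-k_j,k_{j+1},\dots,k_m)$-GPSEDF, where $\overline{A_j}=G\setminus A_j$. (ii) $\{\overline{A_1},\dots,\overline{A_m}\}$ is a non-disjoint $(v,m,v-k_1,\dots,v-k_m)$-GPSEDF in $G$. (iii) For every $g\in G$, $\{A_1,\dots,A_{m-1},g+A_m\}$ is a non-disjoint $(v,m,k_1,\dots,k_m)$-GPSEDF, where $g+A_m=\{g+a:a\in A_m\}$. (iv) Let $B=\{A_1,\dots,A_{m-1},B_m\}$ be a non-disjoint $(v,m,k_1,\dots,k_{m-1},l_m)$-MGPSEDF in $G$. Then $C=\{A_1,\dots,A_{m-1},A_m\uplus B_m\}$ is a non-disjoint $(v,m,k_1,\dots,k_{m-1},k_m+l_m)$-MGPSEDF. If moreover $B$ is a non-disjoint GPSEDF (i.e. $B_m$ is a set) and $A_m$ and $B_m$ are disjoint, then $C$ is a non-disjoint GPSEDF. (v) Let $g_1,\dots,g_n\in G$. Then $\{A_1,\dots,A_{m-1},\uplus_{i=1}^n(g_i+A_m)\}$ is a non-disjoint $(v,m,k_1,\dots,k_{m-1},nk_m)$-MGPSEDF; if the sets $g_i+A_m$ ($1\le i\le n$) are pairwise disjoint, it is a non-disjoint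 GPSEDF.
   Context: For finite multisets $A,B$ of elements of an additively written group $G$, $\Delta(A,B)$ denotes the multiset $\{a-b: a\in A, b\in B\}$, where $a-b=a+(-b)$ and each pair (with multiplicities) contributes one entry. $A\uplus B$ denotes multiset union, and $|A|$ is the size of a multiset counted with multiplicity. For $\lambda\in\mathbb{N}\cup\{0\}$, $\lambda G$ is the multiset containing every element of $G$ exactly $\lambda$ times. Let $|G|=v$. A family of sets $\{A_1,\dots,A_m\}$ in $G$ with $|A_i|=k_i$ is a non-disjoint $(v,m,k_1,\dots,k_m)$-GPSEDF if $\Delta(A_i,A_j)=\lambda_{i,j}G$ with $\lambda_{i,j}=k_ik_j/v$ for all $1\le i\ne j\le m$. A non-disjoint $(v,m,k_1,\dots,k_m)$-MGPSEDF is defined identically except that $A_1,\dots,A_m$ are multisets (with $|A_i|=k_i$ counted with multiplicity). -}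

module Defs where

open import Data.Nat using (ℕ; _*_)
open import Data.Fin using (Fin; _≟_)
open import Data.List using (List; map; concatMap; filter; length; allFin; _++_)
open import Data.List.Relation.Unary.Unique.Propositional using (Unique)
open import Data.List.Relation.Unary.Any using (any?)
open import Data.Product using (Σ; _×_)
open import Relation.Binary.PropositionalEquality using (_≡_; _≢_)
open import Relation.Nullary.Decidable using (¬?)
open import Algebra.Structures using (IsGroup)

-- Every finite group of order v is isomorphic to one whose carrier is Fin v,
-- so we take the carrier to be Fin v with propositional equality.
record FinGroup (v : ℕ) : Set where
  infixl 6 _+_
  field
    _+_     : Fin v → Fin v → Fin v
    0#      : Fin v
    -_      : Fin v → Fin v
    isGroup : IsGroup _≡_ _+_ 0# -_

-- Finite multisets of group elements are lists (all notions below are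
-- invariant under permutation); a set is a list without repetitions.
-- Multiset union ⊎ is list concatenation _++_.

mult : ∀ {v} → Fin v → List (Fin v) → ℕ
mult g xs = length (filter (g ≟_) xs)

module _ {v : ℕ} (G : FinGroup v) where
  open FinGroup G

  Δ : List (Fin v) → List (Fin v) → List (Fin v)
  Δ A B = concatMap (λ a → map (λ b → a + (- b)) B) A

  IsλG : ℕ → List (Fin v) → Set
  IsλG λ′ X = ∀ g → mult g X ≡ λ′

  translate : Fin v → List (Fin v) → List (Fin v)
  translate g X = map (g +_) X

  complement : List (Fin v) → List (Fin v)
  complement X = filter (λ g → ¬? (any? (g ≟_) X)) (allFin v)

  -- non-disjoint (v,m,k_1,…,k_m)-MGPSEDF: multisets A_i with |A_i| = k_i and
  -- Δ(A_i,A_j) = λ_{ij} G with λ_{ij} = k_i k_j / v (i.e. λ_{ij} · v = k_i k_j)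
  MGPSEDF : (m : ℕ) → (Fin m → ℕ) → (Fin m → List (Fin v)) → Set
  MGPSEDF m k A =
    (∀ i → length (A i) ≡ k i) ×
    (∀ i j → i ≢ j → Σ ℕ λ λij → (λij * v ≡ k i * k j) × IsλG λij (Δ (A i) (A j)))

  GPSEDF : (m : ℕ) → (Fin m → ℕ) → (Fin m → List (Fin v)) → Set
  GPSEDF m k A = MGPSEDF m k A × (∀ i → Unique (A i))

{-# OPTIONS --safe #-}
module Submission where

-- The multiplicity of g in Δ(X, Y) is
-- Σ_{x ∈ X} mult (-g + x) Y, so Δ(X, -) is additive under ⊎, sends λG to |X|λG, and turns the
-- translate g + Y into the right translate Δ(X, Y) - g; and Δ(Y, X) = -Δ(X, Y), so the same holds
-- in the first argument. For a set Y we have Y ⊎ (G \ Y) = G, hence Δ(X, G \ Y) = (|X| - λ)G.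
-- Each part of the theorem changes one member of the family, so only the pairs involving that
-- member have to be checked; part (ii) complements the two members of each pair one at a time.

open import Defs
open import Level using (0ℓ)
open import Algebra.Bundles using (Group)
open import Data.Nat using (ℕ; zero; suc; _+_; _*_; _∸_)
open import Data.Nat.Properties
  using (m+n∸n≡m; *-assoc; *-comm; *-zeroʳ; *-identityʳ; *-identityˡ; *-distribʳ-+; *-distribˡ-+; *-distribʳ-∸;
         +-commutativeSemigroup)
open import Algebra.Properties.CommutativeSemigroup +-commutativeSemigroup using (interchange)
open import Data.Fin as Fin using (Fin; fromℕ; _≟_)
open import Data.List using (List; []; _∷_; [_]; _++_; map; concat; tabulate; filter; length; allFin)
open import Data.List.Properties using (filter-++; filter-none; length-++; length-map; length-tabulate)
open import Data.List.Membership.Propositional using (_∈_; _∉_)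
open import Data.List.Membership.Propositional.Properties using (∈-allFin; ∈-filter⁺; ∈-filter⁻)
open import Data.List.Relation.Binary.Disjoint.Propositional using (Disjoint)
open import Data.List.Relation.Unary.Any using (here; there; any?)
import Data.List.Relation.Unary.All.Properties as All
open import Data.List.Relation.Unary.AllPairs using (_∷_)
import Data.List.Relation.Unary.AllPairs.Properties as AllPairs
open import Data.List.Relation.Unary.Unique.Propositional using (Unique)
open import Data.List.Relation.Unary.Unique.Propositional.Properties
  using (allFin⁺; filter⁺; map⁺; ++⁺; concat⁺; Unique[x∷xs]⇒x∉xs)
open import Data.Vec.Functional using (updateAt)
open import Data.Vec.Functional.Properties using (updateAt-updates; updateAt-minimal)
open import Data.Product using (Σ; _×_; _,_; proj₂)
open import Function using (const; id; _∘_)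
open import Function.Definitions using (Injective)
open import Relation.Nullary using (Dec; yes; no; contradiction)
open import Relation.Nullary.Decidable using (¬?)
open import Relation.Binary.PropositionalEquality
  using (_≡_; _≢_; refl; sym; trans; cong; cong₂; subst; subst₂; module ≡-Reasoning)

module _ {v : ℕ} where

  mult-++ : ∀ (x : Fin v) xs ys → mult x (xs ++ ys) ≡ mult x xs + mult x ys
  mult-++ x xs ys = trans (cong length (filter-++ (x ≟_) xs ys)) (length-++ (filter (x ≟_) xs))

  mult-map : ∀ {f : Fin v → Fin v} {x y} → Injective _≡_ _≡_ f → f x ≡ y →
             ∀ xs → mult y (map f xs) ≡ mult x xs
  mult-map inj refl [] = refl
  mult-map {f} {x} inj refl (z ∷ zs) with f x ≟ f z | x ≟ z
  ... | yes _     | yes _   = cong suc (mult-map inj refl zs)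
  ... | no _      | no _    = mult-map inj refl zs
  ... | yes fx≡fz | no x≢z  = contradiction (inj fx≡fz) x≢z
  ... | no fx≢fz  | yes x≡z = contradiction (cong f x≡z) fx≢fz

  mult-∉ : ∀ {x : Fin v} {xs} → x ∉ xs → mult x xs ≡ 0
  mult-∉ {x} {xs} x∉xs = cong length (filter-none (x ≟_) (All.¬Any⇒All¬ xs x∉xs))

  mult-∈-Unique : ∀ {x : Fin v} {xs} → Unique xs → x ∈ xs → mult x xs ≡ 1
  mult-∈-Unique {x} {y ∷ ys} u@(_ ∷ ys-unique) x∈xs with x ≟ y | x∈xs
  ... | yes refl | _          = cong suc (mult-∉ {xs = ys} (Unique[x∷xs]⇒x∉xs u))
  ... | no x≢y   | here x≡y   = contradiction x≡y x≢y
  ... | no _     | there x∈ys = mult-∈-Unique ys-unique x∈ys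

module _ {v : ℕ} (G : FinGroup v) where

  group : Group 0ℓ 0ℓ
  group = record { isGroup = FinGroup.isGroup G }

  open Group group using (_∙_; _⁻¹; ε; _\\_; _//_; assoc)
  open import Algebra.Properties.Group group
    using (∙-cancelˡ; ∙-cancelʳ; ⁻¹-injective; ⁻¹-anti-homo-∙; ⁻¹-anti-homo-\\;
           \\-leftDividesˡ; //-rightDividesʳ)

  mult-//ˡ : ∀ g x Y → mult g (map (x //_) Y) ≡ mult (g \\ x) Y
  mult-//ˡ g x = mult-map (λ e → ⁻¹-injective (∙-cancelˡ x _ _ e))
    (trans (cong (x ∙_) (⁻¹-anti-homo-\\ g x)) (\\-leftDividesˡ x g))

  mult-//ʳ : ∀ g y X → mult g (map (_// y) X) ≡ mult (g ∙ y) X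
  mult-//ʳ g y = mult-map (λ e → ∙-cancelʳ (y ⁻¹) _ _ e) (//-rightDividesʳ y g)

  mult-translate : ∀ h g X → mult h (translate G g X) ≡ mult (g \\ h) X
  mult-translate h g = mult-map (λ e → ∙-cancelˡ g _ _ e) (\\-leftDividesˡ g h)

  mult-Δ-∷ˡ : ∀ g x X Y → mult g (Δ G (x ∷ X) Y) ≡ mult (g \\ x) Y + mult g (Δ G X Y)
  mult-Δ-∷ˡ g x X Y = trans (mult-++ g (map (x //_) Y) (Δ G X Y)) (cong (_+ _) (mult-//ˡ g x Y))

  Δ-[]ʳ-λG : ∀ X → IsλG G 0 (Δ G X [])
  Δ-[]ʳ-λG []      g = refl
  Δ-[]ʳ-λG (x ∷ X) g = Δ-[]ʳ-λG X g

  Δ-[_]ʳ : ∀ y X → Δ G X [ y ] ≡ map (_// y) X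
  Δ-[ y ]ʳ []      = refl
  Δ-[ y ]ʳ (x ∷ X) = cong (x // y ∷_) (Δ-[ y ]ʳ X)

  mult-Δ-++ʳ : ∀ g X Y Z → mult g (Δ G X (Y ++ Z)) ≡ mult g (Δ G X Y) + mult g (Δ G X Z)
  mult-Δ-++ʳ g []      Y Z = refl
  mult-Δ-++ʳ g (x ∷ X) Y Z = begin
    mult g (Δ G (x ∷ X) (Y ++ Z))
      ≡⟨ mult-Δ-∷ˡ g x X (Y ++ Z) ⟩
    mult (g \\ x) (Y ++ Z) + mult g (Δ G X (Y ++ Z))
      ≡⟨ cong₂ _+_ (mult-++ (g \\ x) Y Z) (mult-Δ-++ʳ g X Y Z) ⟩
    (mult (g \\ x) Y + mult (g \\ x) Z) + (mult g (Δ G X Y) + mult g (Δ G X Z))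
      ≡⟨ interchange (mult (g \\ x) Y) (mult (g \\ x) Z) (mult g (Δ G X Y)) (mult g (Δ G X Z)) ⟩
    (mult (g \\ x) Y + mult g (Δ G X Y)) + (mult (g \\ x) Z + mult g (Δ G X Z))
      ≡⟨ cong₂ _+_ (mult-Δ-∷ˡ g x X Y) (mult-Δ-∷ˡ g x X Z) ⟨
    mult g (Δ G (x ∷ X) Y) + mult g (Δ G (x ∷ X) Z) ∎
    where open ≡-Reasoning

  mult-Δ-swap : ∀ g X Y → mult g (Δ G Y X) ≡ mult (g ⁻¹) (Δ G X Y)
  mult-Δ-swap g X []      = sym (Δ-[]ʳ-λG X (g ⁻¹))
  mult-Δ-swap g X (y ∷ Y) = begin
    mult g (Δ G (y ∷ Y) X)
      ≡⟨ mult-Δ-∷ˡ g y Y X ⟩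
    mult (g ⁻¹ ∙ y) X + mult g (Δ G Y X)
      ≡⟨ cong₂ _+_ (sym (mult-//ʳ (g ⁻¹) y X)) (mult-Δ-swap g X Y) ⟩
    mult (g ⁻¹) (map (_// y) X) + mult (g ⁻¹) (Δ G X Y)
      ≡⟨ cong (λ Z → mult (g ⁻¹) Z + _) (Δ-[ y ]ʳ X) ⟨
    mult (g ⁻¹) (Δ G X [ y ]) + mult (g ⁻¹) (Δ G X Y)
      ≡⟨ mult-Δ-++ʳ (g ⁻¹) X [ y ] Y ⟨
    mult (g ⁻¹) (Δ G X (y ∷ Y)) ∎
    where open ≡-Reasoning

  Δ-λGʳ : ∀ {μ Y} X → IsλG G μ Y → IsλG G (length X * μ) (Δ G X Y)
  Δ-λGʳ []          Y-λG g = refl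
  Δ-λGʳ {Y = Y} (x ∷ X) Y-λG g =
    trans (mult-Δ-∷ˡ g x X Y) (cong₂ _+_ (Y-λG (g \\ x)) (Δ-λGʳ X Y-λG g))

  mult-Δ-translateʳ : ∀ h g X Y → mult h (Δ G X (translate G g Y)) ≡ mult (h ∙ g) (Δ G X Y)
  mult-Δ-translateʳ h g []      Y = refl
  mult-Δ-translateʳ h g (x ∷ X) Y = begin
    mult h (Δ G (x ∷ X) (translate G g Y))
      ≡⟨ mult-Δ-∷ˡ h x X (translate G g Y) ⟩
    mult (h \\ x) (translate G g Y) + mult h (Δ G X (translate G g Y))
      ≡⟨ cong₂ _+_ (mult-translate (h \\ x) g Y) (mult-Δ-translateʳ h g X Y) ⟩
    mult (g \\ (h \\ x)) Y + mult (h ∙ g) (Δ G X Y)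
      ≡⟨ cong (λ z → mult z Y + mult (h ∙ g) (Δ G X Y)) [h∙g]\\x≡g\\[h\\x] ⟨
    mult ((h ∙ g) \\ x) Y + mult (h ∙ g) (Δ G X Y)
      ≡⟨ mult-Δ-∷ˡ (h ∙ g) x X Y ⟨
    mult (h ∙ g) (Δ G (x ∷ X) Y) ∎
    where
    open ≡-Reasoning
    [h∙g]\\x≡g\\[h\\x] : (h ∙ g) \\ x ≡ g \\ (h \\ x)
    [h∙g]\\x≡g\\[h\\x] = trans (cong (_∙ x) (⁻¹-anti-homo-∙ h g)) (assoc (g ⁻¹) (h ⁻¹) x)

  allFin-λG : IsλG G 1 (allFin v)
  allFin-λG g = mult-∈-Unique (allFin⁺ v) (∈-allFin g)

  -- Double counting in Δ(Z, G) = -Δ(G, Z): the former is |Z| G, the latter v μ G.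
  length-λG : ∀ {μ} Z → IsλG G μ Z → length Z ≡ μ * v
  length-λG {μ} Z Z-λG = begin
    length Z                        ≡⟨ *-identityʳ (length Z) ⟨
    length Z * 1                    ≡⟨ Δ-λGʳ Z allFin-λG ε ⟨
    mult ε (Δ G Z (allFin v))       ≡⟨ mult-Δ-swap ε (allFin v) Z ⟩
    mult (ε ⁻¹) (Δ G (allFin v) Z)  ≡⟨ Δ-λGʳ (allFin v) Z-λG (ε ⁻¹) ⟩
    length (allFin v) * μ           ≡⟨ cong (_* μ) (length-tabulate {n = v} id) ⟩
    v * μ                           ≡⟨ *-comm v μ ⟩
    μ * v                           ∎
    where open ≡-Reasoning

  complement-Unique : ∀ Y → Unique (complement G Y)
  complement-Unique Y = filter⁺ (λ g → ¬? (any? (g ≟_) Y)) (allFin⁺ v)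

  complement-++-λG : ∀ {Y} → Unique Y → IsλG G 1 (complement G Y ++ Y)
  complement-++-λG {Y} Y-unique h = trans (mult-++ h (complement G Y) Y) (count (any? (h ≟_) Y))
    where
    ∉Y? : ∀ g → Dec (g ∉ Y)
    ∉Y? g = ¬? (any? (g ≟_) Y)
    count : Dec (h ∈ Y) → mult h (complement G Y) + mult h Y ≡ 1
    count (yes h∈Y) = cong₂ _+_ (mult-∉ {xs = complement G Y} h∉cY) (mult-∈-Unique Y-unique h∈Y)
      where
      h∉cY : h ∉ complement G Y
      h∉cY h∈cY = proj₂ (∈-filter⁻ ∉Y? {xs = allFin v} h∈cY) h∈Y
    count (no h∉Y)  = cong₂ _+_ (mult-∈-Unique (complement-Unique Y) h∈cY) (mult-∉ {xs = Y} h∉Y)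
      where
      h∈cY : h ∈ complement G Y
      h∈cY = ∈-filter⁺ ∉Y? (∈-allFin h) h∉Y

  length-complement : ∀ {Y} → Unique Y → length (complement G Y) ≡ v ∸ length Y
  length-complement {Y} Y-unique = begin
    length (complement G Y)                        ≡⟨ m+n∸n≡m _ (length Y) ⟨
    length (complement G Y) + length Y ∸ length Y  ≡⟨ cong (_∸ length Y) (length-++ (complement G Y)) ⟨
    length (complement G Y ++ Y) ∸ length Y        ≡⟨ cong (_∸ length Y) length-G ⟩
    1 * v ∸ length Y                               ≡⟨ cong (_∸ length Y) (*-identityˡ v) ⟩
    v ∸ length Y                                   ∎
    where
    open ≡-Reasoning
    length-G : length (complement G Y ++ Y) ≡ 1 * v
    length-G = length-λG (complement G Y ++ Y) (complement-++-λG Y-unique)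

  -- The condition MGPSEDF imposes on a pair of members, as a record so that X, a, Y, b are inferable.
  record Balanced (X : List (Fin v)) (a : ℕ) (Y : List (Fin v)) (b : ℕ) : Set where
    constructor balanced
    field
      λ′        : ℕ
      λ′*v≡a*b  : λ′ * v ≡ a * b
      Δ≡λ′G     : IsλG G λ′ (Δ G X Y)

  toBalanced : ∀ {X a Y b} → (Σ ℕ λ λ′ → (λ′ * v ≡ a * b) × IsλG G λ′ (Δ G X Y)) → Balanced X a Y b
  toBalanced (λ′ , λ′*v≡a*b , Δ≡λ′G) = balanced λ′ λ′*v≡a*b Δ≡λ′G

  fromBalanced : ∀ {X a Y b} → Balanced X a Y b → Σ ℕ λ λ′ → (λ′ * v ≡ a * b) × IsλG G λ′ (Δ G X Y)
  fromBalanced (balanced λ′ λ′*v≡a*b Δ≡λ′G) = λ′ , λ′*v≡a*b , Δ≡λ′G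

  Balanced-swap : ∀ {X a Y b} → Balanced X a Y b → Balanced Y b X a
  Balanced-swap {X} {a} {Y} {b} (balanced λ′ e Δ≡λ′G) =
    balanced λ′ (trans e (*-comm a b)) (λ g → trans (mult-Δ-swap g X Y) (Δ≡λ′G (g ⁻¹)))

  Balanced-λGʳ : ∀ {X a μ Y} → length X ≡ a → IsλG G μ Y → Balanced X a Y (μ * v)
  Balanced-λGʳ {X} {a} {μ} refl Y-λG = balanced (a * μ) (*-assoc a μ v) (Δ-λGʳ X Y-λG)

  Balanced-[]ʳ : ∀ {X a} → Balanced X a [] 0
  Balanced-[]ʳ {X} {a} = balanced 0 (sym (*-zeroʳ a)) (Δ-[]ʳ-λG X)

  Balanced-++ʳ : ∀ {X a Y b Z c} → Balanced X a Y b → Balanced X a Z c → Balanced X a (Y ++ Z) (b + c)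
  Balanced-++ʳ {X} {a} {Y} {b} {Z} {c} (balanced λ₁ e₁ Δ₁) (balanced λ₂ e₂ Δ₂) =
    balanced (λ₁ + λ₂) λ*v≡a*[b+c] (λ g → trans (mult-Δ-++ʳ g X Y Z) (cong₂ _+_ (Δ₁ g) (Δ₂ g)))
    where
    open ≡-Reasoning
    λ*v≡a*[b+c] : (λ₁ + λ₂) * v ≡ a * (b + c)
    λ*v≡a*[b+c] = begin
      (λ₁ + λ₂) * v     ≡⟨ *-distribʳ-+ v λ₁ λ₂ ⟩
      λ₁ * v + λ₂ * v   ≡⟨ cong₂ _+_ e₁ e₂ ⟩
      a * b + a * c     ≡⟨ *-distribˡ-+ a b c ⟨
      a * (b + c)       ∎

  Balanced-cancelʳ : ∀ {X a Y b Z c d} → Balanced X a (Z ++ Y) d → Balanced X a Y b → c + b ≡ d →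
                     Balanced X a Z c
  Balanced-cancelʳ {X} {a} {Y} {b} {Z} {c} (balanced λ₁ e₁ Δ₁) (balanced λ₂ e₂ Δ₂) refl =
    balanced (λ₁ ∸ λ₂) λ*v≡a*c Δ≡λG
    where
    open ≡-Reasoning
    λ*v≡a*c : (λ₁ ∸ λ₂) * v ≡ a * c
    λ*v≡a*c = begin
      (λ₁ ∸ λ₂) * v             ≡⟨ *-distribʳ-∸ v λ₁ λ₂ ⟩
      λ₁ * v ∸ λ₂ * v           ≡⟨ cong₂ _∸_ e₁ e₂ ⟩
      a * (c + b) ∸ a * b       ≡⟨ cong (_∸ a * b) (*-distribˡ-+ a c b) ⟩
      a * c + a * b ∸ a * b     ≡⟨ m+n∸n≡m (a * c) (a * b) ⟩
      a * c                     ∎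
    Δ≡λG : IsλG G (λ₁ ∸ λ₂) (Δ G X Z)
    Δ≡λG g = begin
      mult g (Δ G X Z)
        ≡⟨ m+n∸n≡m _ (mult g (Δ G X Y)) ⟨
      mult g (Δ G X Z) + mult g (Δ G X Y) ∸ mult g (Δ G X Y)
        ≡⟨ cong (_∸ mult g (Δ G X Y)) (mult-Δ-++ʳ g X Z Y) ⟨
      mult g (Δ G X (Z ++ Y)) ∸ mult g (Δ G X Y)
        ≡⟨ cong₂ _∸_ (Δ₁ g) (Δ₂ g) ⟩
      λ₁ ∸ λ₂ ∎

  Balanced-translateʳ : ∀ {X a Y b} g → Balanced X a Y b → Balanced X a (translate G g Y) b
  Balanced-translateʳ {X} {Y = Y} g (balanced λ′ e Δ≡λ′G) =
    balanced λ′ e (λ h → trans (mult-Δ-translateʳ h g X Y) (Δ≡λ′G (h ∙ g)))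

  Balanced-complementʳ : ∀ {X a Y b} → length X ≡ a → length Y ≡ b → Unique Y → Balanced X a Y b →
                         Balanced X a (complement G Y) (v ∸ b)
  Balanced-complementʳ {Y = Y} lenX refl Y-unique XY =
    Balanced-cancelʳ (Balanced-λGʳ lenX (complement-++-λG Y-unique)) XY sizes
    where
    open ≡-Reasoning
    sizes : v ∸ length Y + length Y ≡ 1 * v
    sizes = begin
      v ∸ length Y + length Y      ≡⟨ cong (_+ length Y) (length-complement Y-unique) ⟨
      length (complement G Y) + length Y
                                   ≡⟨ length-++ (complement G Y) ⟨
      length (complement G Y ++ Y) ≡⟨ length-λG (complement G Y ++ Y) (complement-++-λG Y-unique) ⟩
      1 * v                        ∎

  Balanced-complement : ∀ {X a Y b} → length X ≡ a → length Y ≡ b → Unique X → Unique Y →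
                        Balanced X a Y b → Balanced (complement G X) (v ∸ a) (complement G Y) (v ∸ b)
  Balanced-complement {Y = Y} {b} lenX lenY X-unique Y-unique XY =
    Balanced-swap (Balanced-complementʳ lenY′ lenX X-unique
      (Balanced-swap (Balanced-complementʳ lenX lenY Y-unique XY)))
    where
    lenY′ : length (complement G Y) ≡ v ∸ b
    lenY′ = trans (length-complement Y-unique) (cong (v ∸_) lenY)

  Balanced-concatʳ : ∀ {X a b} n (Ys : Fin n → List (Fin v)) → (∀ i → Balanced X a (Ys i) b) →
                     Balanced X a (concat (tabulate Ys)) (n * b)
  Balanced-concatʳ zero    Ys XYs = Balanced-[]ʳ
  Balanced-concatʳ (suc n) Ys XYs =
    Balanced-++ʳ (XYs Fin.zero) (Balanced-concatʳ n (Ys ∘ Fin.suc) (XYs ∘ Fin.suc))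

  length-concat-tabulate : ∀ {b} n (Ys : Fin n → List (Fin v)) → (∀ i → length (Ys i) ≡ b) →
                           length (concat (tabulate Ys)) ≡ n * b
  length-concat-tabulate zero    Ys lenYs = refl
  length-concat-tabulate (suc n) Ys lenYs =
    trans (length-++ (Ys Fin.zero))
          (cong₂ _+_ (lenYs Fin.zero) (length-concat-tabulate n (Ys ∘ Fin.suc) (lenYs ∘ Fin.suc)))

  translate-Unique : ∀ g {X} → Unique X → Unique (translate G g X)
  translate-Unique g = map⁺ (λ e → ∙-cancelˡ g _ _ e)

  translates-Unique : ∀ {n} (gs : Fin n → Fin v) {X} → Unique X →
                      (∀ i j → i ≢ j → Disjoint (translate G (gs i) X) (translate G (gs j) X)) →
                      Unique (concat (tabulate (λ i → translate G (gs i) X)))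
  translates-Unique gs X-unique disjoint =
    concat⁺ (All.tabulate⁺ (λ i → translate-Unique (gs i) X-unique)) (AllPairs.tabulate⁺ (disjoint _ _))

  Unique-updateAt : ∀ {m} {A : Fin m → List (Fin v)} → (∀ i → Unique (A i)) →
                    ∀ j (F : List (Fin v) → List (Fin v)) → Unique (F (A j)) → ∀ i → Unique (updateAt A j F i)
  Unique-updateAt {A = A} uniques j F unique-j i with i ≟ j
  ... | yes refl = subst Unique (sym (updateAt-updates i {F} A)) unique-j
  ... | no i≢j   = subst Unique (sym (updateAt-minimal i j A i≢j)) (uniques i)

  module _ {m} {k : Fin m → ℕ} {A : Fin m → List (Fin v)} where

    MGPSEDF-replace : MGPSEDF G m k A → ∀ j {k′ : Fin m → ℕ} {A′ : Fin m → List (Fin v)} →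
                      (∀ i → i ≢ j → k′ i ≡ k i) → (∀ i → i ≢ j → A′ i ≡ A i) →
                      length (A′ j) ≡ k′ j → (∀ i → i ≢ j → Balanced (A i) (k i) (A′ j) (k′ j)) →
                      MGPSEDF G m k′ A′
    MGPSEDF-replace (lengths , pairs) j {k′} {A′} k′≡k A′≡A length-j balanced-j =
      lengths′ , λ i i′ i≢i′ → fromBalanced (pairs′ i i′ i≢i′)
      where
      lengths′ : ∀ i → length (A′ i) ≡ k′ i
      lengths′ i with i ≟ j
      ... | yes refl = length-j
      ... | no i≢j rewrite k′≡k i i≢j | A′≡A i i≢j = lengths i
      pairs′ : ∀ i i′ → i ≢ i′ → Balanced (A′ i) (k′ i) (A′ i′) (k′ i′)
      pairs′ i i′ i≢i′ with i ≟ j | i′ ≟ j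
      ... | yes refl | yes refl = contradiction refl i≢i′
      ... | yes refl | no i′≢j
        rewrite k′≡k i′ i′≢j | A′≡A i′ i′≢j = Balanced-swap (balanced-j i′ i′≢j)
      ... | no i≢j   | yes refl
        rewrite k′≡k i i≢j | A′≡A i i≢j = balanced-j i i≢j
      ... | no i≢j   | no i′≢j
        rewrite k′≡k i i≢j | A′≡A i i≢j | k′≡k i′ i′≢j | A′≡A i′ i′≢j = toBalanced (pairs i i′ i≢i′)

    MGPSEDF-updateAt : MGPSEDF G m k A → ∀ j (f : ℕ → ℕ) (F : List (Fin v) → List (Fin v)) →
                       length (F (A j)) ≡ f (k j) → (∀ i → i ≢ j → Balanced (A i) (k i) (F (A j)) (f (k j))) →
                       MGPSEDF G m (updateAt k j f) (updateAt A j F)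
    MGPSEDF-updateAt M j f F length-j balanced-j =
      MGPSEDF-replace M j (λ i → updateAt-minimal i j k) (λ i → updateAt-minimal i j A)
        (subst₂ (λ X a → length X ≡ a) (sym F-at-j) (sym f-at-j) length-j)
        (λ i i≢j → subst₂ (Balanced (A i) (k i)) (sym F-at-j) (sym f-at-j) (balanced-j i i≢j))
      where
      F-at-j : updateAt A j F j ≡ F (A j)
      F-at-j = updateAt-updates j A
      f-at-j : updateAt k j f j ≡ f (k j)
      f-at-j = updateAt-updates j k

    MGPSEDF-updateAt⁻ : ∀ j {f : ℕ → ℕ} {F : List (Fin v) → List (Fin v)} →
                        MGPSEDF G m (updateAt k j f) (updateAt A j F) →
                        length (F (A j)) ≡ f (k j) × (∀ i → i ≢ j → Balanced (A i) (k i) (F (A j)) (f (k j)))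
    MGPSEDF-updateAt⁻ j {f} {F} (lengths , pairs) =
      subst₂ (λ X a → length X ≡ a) F-at-j f-at-j (lengths j) ,
      λ i i≢j → subst₂ (λ X a → Balanced X a (F (A j)) (f (k j)))
                  (updateAt-minimal i j A i≢j) (updateAt-minimal i j k i≢j)
                  (subst₂ (Balanced _ _) F-at-j f-at-j (toBalanced (pairs i j i≢j)))
      where
      F-at-j : updateAt A j F j ≡ F (A j)
      F-at-j = updateAt-updates j A
      f-at-j : updateAt k j f j ≡ f (k j)
      f-at-j = updateAt-updates j k

    MGPSEDF-complementAt : MGPSEDF G m k A → ∀ j → Unique (A j) →
                           MGPSEDF G m (updateAt k j (v ∸_)) (updateAt A j (complement G))
    MGPSEDF-complementAt M@(lengths , pairs) j unique-j =
      MGPSEDF-updateAt M j (v ∸_) (complement G)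
        (trans (length-complement unique-j) (cong (v ∸_) (lengths j)))
        (λ i i≢j → Balanced-complementʳ (lengths i) (lengths j) unique-j (toBalanced (pairs i j i≢j)))

    MGPSEDF-complement : MGPSEDF G m k A → (∀ i → Unique (A i)) →
                         MGPSEDF G m (λ i → v ∸ k i) (λ i → complement G (A i))
    MGPSEDF-complement (lengths , pairs) uniques =
      (λ i → trans (length-complement (uniques i)) (cong (v ∸_) (lengths i))) ,
      λ i i′ i≢i′ → fromBalanced (Balanced-complement (lengths i) (lengths i′) (uniques i) (uniques i′)
                                    (toBalanced (pairs i i′ i≢i′)))

    MGPSEDF-translateAt : MGPSEDF G m k A → ∀ j g → MGPSEDF G m k (updateAt A j (translate G g))
    MGPSEDF-translateAt M@(lengths , pairs) j g =
      MGPSEDF-replace M j (λ _ _ → refl) (λ i → updateAt-minimal i j A)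
        (subst (λ X → length X ≡ k j) (sym g+A-at-j) (trans (length-map (g ∙_) (A j)) (lengths j)))
        (λ i i≢j → subst (λ Y → Balanced (A i) (k i) Y (k j)) (sym g+A-at-j)
                     (Balanced-translateʳ g (toBalanced (pairs i j i≢j))))
      where
      g+A-at-j : updateAt A j (translate G g) j ≡ translate G g (A j)
      g+A-at-j = updateAt-updates j A

    MGPSEDF-++At : MGPSEDF G m k A → ∀ j l B →
                   MGPSEDF G m (updateAt k j (const l)) (updateAt A j (const B)) →
                   MGPSEDF G m (updateAt k j (_+ l)) (updateAt A j (_++ B))
    MGPSEDF-++At M@(lengths , pairs) j l B MB with MGPSEDF-updateAt⁻ j MB
    ... | length-B , balanced-B =
      MGPSEDF-updateAt M j (_+ l) (_++ B)
        (trans (length-++ (A j)) (cong₂ _+_ (lengths j) length-B))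
        (λ i i≢j → Balanced-++ʳ (toBalanced (pairs i j i≢j)) (balanced-B i i≢j))

    MGPSEDF-translatesAt : MGPSEDF G m k A → ∀ j n (gs : Fin n → Fin v) →
                           MGPSEDF G m (updateAt k j (n *_))
                             (updateAt A j (λ X → concat (tabulate (λ i → translate G (gs i) X))))
    MGPSEDF-translatesAt M@(lengths , pairs) j n gs =
      MGPSEDF-updateAt M j (n *_) (λ X → concat (tabulate (λ i → translate G (gs i) X)))
        (length-concat-tabulate n _ (λ i → trans (length-map (gs i ∙_) (A j)) (lengths j)))
        (λ i i≢j → Balanced-concatʳ n _ (λ i′ → Balanced-translateʳ (gs i′) (toBalanced (pairs i j i≢j))))

theorem2p24 : (v : ℕ) (G : FinGroup v) (m′ : ℕ) (k : Fin (suc m′) → ℕ)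
    (A : Fin (suc m′) → List (Fin v)) →
    GPSEDF G (suc m′) k A →
    -- (i)
    (∀ j → GPSEDF G (suc m′) (updateAt k j (v ∸_)) (updateAt A j (complement G)))
    -- (ii)
    × GPSEDF G (suc m′) (λ i → v ∸ k i) (λ i → complement G (A i))
    -- (iii)
    × (∀ g → GPSEDF G (suc m′) k (updateAt A (fromℕ m′) (translate G g)))
    -- (iv)
    × (∀ (l : ℕ) (B : List (Fin v)) →
         MGPSEDF G (suc m′) (updateAt k (fromℕ m′) (const l)) (updateAt A (fromℕ m′) (const B)) →
         MGPSEDF G (suc m′) (updateAt k (fromℕ m′) (_+ l)) (updateAt A (fromℕ m′) (_++ B))
         × (GPSEDF G (suc m′) (updateAt k (fromℕ m′) (const l)) (updateAt A (fromℕ m′) (const B)) →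
            Disjoint (A (fromℕ m′)) B →
            GPSEDF G (suc m′) (updateAt k (fromℕ m′) (_+ l)) (updateAt A (fromℕ m′) (_++ B))))
    -- (v)
    × (∀ (n : ℕ) (gs : Fin n → Fin v) →
         MGPSEDF G (suc m′) (updateAt k (fromℕ m′) (n *_))
           (updateAt A (fromℕ m′) (λ X → concat (tabulate (λ i → translate G (gs i) X))))
         × ((∀ i j → i ≢ j → Disjoint (translate G (gs i) (A (fromℕ m′))) (translate G (gs j) (A (fromℕ m′)))) →
            GPSEDF G (suc m′) (updateAt k (fromℕ m′) (n *_))
              (updateAt A (fromℕ m′) (λ X → concat (tabulate (λ i → translate G (gs i) X))))))
theorem2p24 v G m′ k A (M , uniques) =
    (λ j → MGPSEDF-complementAt G M j (uniques j) , unique-at j (complement G) (complement-Unique G (A j)))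
  , (MGPSEDF-complement G M uniques , λ i → complement-Unique G (A i))
  , (λ g → MGPSEDF-translateAt G M last g , unique-at last (translate G g) (translate-Unique G g (uniques last)))
  , (λ l B MB → MGPSEDF-++At G M last l B MB ,
       λ (MB′ , uniques′) disjoint → MGPSEDF-++At G M last l B MB′ ,
         unique-at last (_++ B) (++⁺ (uniques last) (B-unique uniques′) disjoint))
  , λ n gs → MGPSEDF-translatesAt G M last n gs ,
       λ disjoint → MGPSEDF-translatesAt G M last n gs ,
         unique-at last _ (translates-Unique G gs (uniques last) disjoint)
  where
  last : Fin (suc m′)
  last = fromℕ m′
  unique-at : ∀ j (F : List (Fin v) → List (Fin v)) → Unique (F (A j)) → ∀ i → Unique (updateAt A j F i)
  unique-at = Unique-updateAt G uniques
  B-unique : ∀ {B} → (∀ i → Unique (updateAt A last (const B) i)) → Unique B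
  B-unique uniques′ = subst Unique (updateAt-updates last A) (uniques′ last)
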